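{- Let $M=(V,\beta)$ be a matroid over $V$, described by its set of bases $\beta$ (viewed as the set system $(V,\beta)$). Then $t_M(y,y)=q_1(M)(y-1)$, i.e., the Tutte polynomial on the diagonal equals $q_1(M)$ with its variable replaced by $y-1$.
   Context: For a proper set system $M=(V,D)$ (i.e. $D$ a nonempty family of subsets of the finite set $V$) and $X\subseteq V$, the pivot is $M*X=(V,\{Z\oplus X:Z\in D\})$ with $\oplus$ symmetric difference, and $d_M(X)=\min\{|X\oplus Z|: Z\in D\}$, $d_M=d_M(\emptyset)$. The polynomial $q_1$ is $q_1(M)(y)=\sum_{X\subseteq V} y^{d_{M*X}}$ (equivalently $\sum_{X\subseteq V}y^{d_M(X)}$). For a matroid with set of bases $\beta$, the nullity of $X\subseteq V$ is $n(X)=\min\{|X\setminus Y|: Y\in\beta\}$, the rank is $r(X)=|X|-n(X)$, and the Tutte polynomial is $t_M(x,y)=\sum_{X\subseteq V}(x-1)^{r(V)-r(X)}(y-1)^{n(X)}$. -}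

module Defs where

open import Data.Nat as ℕ using (ℕ; zero; suc; _⊓_; _∸_)
open import Data.Bool using (Bool; true; false; _xor_)
open import Data.Vec using (Vec; []; _∷_; zipWith)
open import Data.List as List using (List; []; _∷_; _++_)
open import Data.List.NonEmpty as List⁺ using (List⁺; _∷_)
open import Data.Fin.Subset using (Subset; _─_; _∈_; _∉_; _∪_; ⁅_⁆; _-_; ∣_∣; ⊤; ⊥)
open import Data.Fin using (Fin)
open import Data.Product using (Σ; _×_; ∃-syntax)
open import Data.Integer as ℤ using (ℤ)
open import Data.List.Relation.Unary.Any using (Any)
open import Relation.Binary.PropositionalEquality using (_≡_)

-- A proper set system (V , D) on Fin n: D a nonempty finite family of subsets,
-- represented as a nonempty list (duplicates are harmless for all notions below).
SetSystem : ℕ → Set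
SetSystem n = List⁺ (Subset n)

_∈F_ : ∀ {n} → Subset n → SetSystem n → Set
Z ∈F D = Any (λ W → W ≡ Z) (List⁺.toList D)

_⊕_ : ∀ {n} → Subset n → Subset n → Subset n
X ⊕ Y = zipWith _xor_ X Y

allSubsets : ∀ n → List (Subset n)
allSubsets zero    = [] ∷ []
allSubsets (suc n) = List.map (false ∷_) (allSubsets n) ++ List.map (true ∷_) (allSubsets n)

min⁺ : ∀ {A : Set} → (A → ℕ) → List⁺ A → ℕ
min⁺ f (x ∷ xs) = List.foldr (λ y m → f y ⊓ m) (f x) xs

pivot : ∀ {n} → SetSystem n → Subset n → SetSystem n
pivot D X = List⁺.map (λ Z → Z ⊕ X) D

dist : ∀ {n} → SetSystem n → Subset n → ℕ
dist D X = min⁺ (λ Z → ∣ X ⊕ Z ∣) D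

d : ∀ {n} → SetSystem n → ℕ
d D = dist D ⊥

sumℤ : ∀ {A : Set} → (A → ℤ) → List A → ℤ
sumℤ f = List.foldr (λ a s → f a ℤ.+ s) (ℤ.+ 0)

q₁ : ∀ {n} → SetSystem n → ℤ → ℤ
q₁ {n} D y = sumℤ (λ X → y ℤ.^ d (pivot D X)) (allSubsets n)

IsMatroid : ∀ {n} → SetSystem n → Set
IsMatroid {n} β =
  ∀ (B₁ B₂ : Subset n) → B₁ ∈F β → B₂ ∈F β →
  ∀ (x : Fin n) → x ∈ B₁ → x ∉ B₂ →
  ∃[ y ] (y ∈ B₂ × y ∉ B₁ × (((B₁ - x) ∪ ⁅ y ⁆) ∈F β))

nullity : ∀ {n} → SetSystem n → Subset n → ℕ
nullity β X = min⁺ (λ Y → ∣ X ─ Y ∣) β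

rank : ∀ {n} → SetSystem n → Subset n → ℕ
rank β X = ∣ X ∣ ∸ nullity β X

tutte : ∀ {n} → SetSystem n → ℤ → ℤ → ℤ
tutte {n} β x y =
  sumℤ (λ X → ((x ℤ.- ℤ.+ 1) ℤ.^ (rank β ⊤ ∸ rank β X)) ℤ.* ((y ℤ.- ℤ.+ 1) ℤ.^ nullity β X))
       (allSubsets n)

-- On a matroid all bases B have the same size r, so for every X ⊆ V
--   |B ⊕ X| = |X ∖ B| + |B ∖ X| = 2 |X ∖ B| + r − |X|.
-- Minimising over B gives d_M(X) = 2 n(X) + r − |X|, while r(V) = r and
-- r(X) = |X| − n(X) give r(V) − r(X) + n(X) = r − |X| + 2 n(X) as well.
-- Hence each summand (y−1)^{r(V)−r(X)} (y−1)^{n(X)} of t_M(y,y) equals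
-- the summand (y−1)^{d_{M*X}} of q₁(M)(y−1).
module Submission where

open import Defs
open import Data.Nat using (ℕ; zero; suc; _⊓_; _∸_; _+_; _≤_; _<_; z<s)
open import Data.Nat.Properties
open import Data.Bool.Properties using (xor-comm; xor-identityˡ)
open import Data.Vec using ([]; _∷_; here; there)
open import Data.Vec.Properties using (zipWith-comm; zipWith-identityˡ)
open import Data.List using (List; []; _∷_)
open import Data.List.Properties using (foldr-map; foldr-cong)
open import Data.List.NonEmpty as List⁺ using (List⁺; _∷_)
open import Data.List.Relation.Unary.Any as Any using (Any)
open import Data.Fin using (Fin; zero; suc)
open import Data.Fin.Subset
  using (Subset; Nonempty; _─_; _∈_; _∉_; _∪_; ⁅_⁆; ∣_∣; ⊤; ⊥; outside; inside)
open import Data.Fin.Subset.Properties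
  using (p─⊤≡⊥; p─⊥≡p; ∣⊥∣≡0; ∣⊤∣≡n; ∣p∣≤n; ∣p─q∣≤∣p∣; p─q⊆p; p─q─r≡p─r─q;
         nonempty?; Empty-unique; ∪-identityʳ)
open import Data.Product using (_,_)
open import Data.Integer as ℤ using (ℤ; _-_; +_)
open import Data.Integer.Properties as ℤ using ()
open import Data.Nat.Solver using (module +-*-Solver)
open import Function using (_∘_)
open import Relation.Binary using (_Preserves_⟶_)
open import Relation.Binary.PropositionalEquality
open import Relation.Nullary using (yes; no; contradiction)

private
  variable
    n : ℕ
    A B : Set

⊕-comm : (p q : Subset n) → p ⊕ q ≡ q ⊕ p
⊕-comm = zipWith-comm xor-comm

⊕-identityˡ : (p : Subset n) → ⊥ ⊕ p ≡ p
⊕-identityˡ = zipWith-identityˡ xor-identityˡ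

∣p⊕q∣≡∣p─q∣+∣q─p∣ : (p q : Subset n) → ∣ p ⊕ q ∣ ≡ ∣ p ─ q ∣ + ∣ q ─ p ∣
∣p⊕q∣≡∣p─q∣+∣q─p∣ []            []            = refl
∣p⊕q∣≡∣p─q∣+∣q─p∣ (outside ∷ p) (outside ∷ q) = ∣p⊕q∣≡∣p─q∣+∣q─p∣ p q
∣p⊕q∣≡∣p─q∣+∣q─p∣ (inside  ∷ p) (inside  ∷ q) = ∣p⊕q∣≡∣p─q∣+∣q─p∣ p q
∣p⊕q∣≡∣p─q∣+∣q─p∣ (inside  ∷ p) (outside ∷ q) = cong suc (∣p⊕q∣≡∣p─q∣+∣q─p∣ p q)
∣p⊕q∣≡∣p─q∣+∣q─p∣ (outside ∷ p) (inside  ∷ q) =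
  trans (cong suc (∣p⊕q∣≡∣p─q∣+∣q─p∣ p q)) (sym (+-suc _ _))

∣p∣+∣q─p∣≡∣q∣+∣p─q∣ : (p q : Subset n) → ∣ p ∣ + ∣ q ─ p ∣ ≡ ∣ q ∣ + ∣ p ─ q ∣
∣p∣+∣q─p∣≡∣q∣+∣p─q∣ []            []            = refl
∣p∣+∣q─p∣≡∣q∣+∣p─q∣ (outside ∷ p) (outside ∷ q) = ∣p∣+∣q─p∣≡∣q∣+∣p─q∣ p q
∣p∣+∣q─p∣≡∣q∣+∣p─q∣ (inside  ∷ p) (inside  ∷ q) = cong suc (∣p∣+∣q─p∣≡∣q∣+∣p─q∣ p q)
∣p∣+∣q─p∣≡∣q∣+∣p─q∣ (inside  ∷ p) (outside ∷ q) =
  trans (cong suc (∣p∣+∣q─p∣≡∣q∣+∣p─q∣ p q)) (sym (+-suc _ _))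
∣p∣+∣q─p∣≡∣q∣+∣p─q∣ (outside ∷ p) (inside  ∷ q) =
  trans (+-suc _ _) (cong suc (∣p∣+∣q─p∣≡∣q∣+∣p─q∣ p q))

∣p∣>0⇒Nonempty : {n : ℕ} (p : Subset n) → 0 < ∣ p ∣ → Nonempty p
∣p∣>0⇒Nonempty {n} p 0<∣p∣ with nonempty? p
... | yes ne = ne
... | no ¬ne = contradiction (trans (cong ∣_∣ (Empty-unique ¬ne)) (∣⊥∣≡0 n)) (>⇒≢ 0<∣p∣)

x∈p─q⇒x∉q : {x : Fin n} (p q : Subset n) → x ∈ p ─ q → x ∉ q
x∈p─q⇒x∉q (_ ∷ p) (outside ∷ q) here        ()
x∈p─q⇒x∉q (_ ∷ p) (_       ∷ q) (there x∈) (there x∈q) = x∈p─q⇒x∉q p q x∈ x∈q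

x∈p⇒1+∣p-x∣≡∣p∣ : {x : Fin n} (p : Subset n) → x ∈ p → suc ∣ p ─ ⁅ x ⁆ ∣ ≡ ∣ p ∣
x∈p⇒1+∣p-x∣≡∣p∣ (inside  ∷ p) here        = cong (suc ∘ ∣_∣) (p─⊥≡p p)
x∈p⇒1+∣p-x∣≡∣p∣ (outside ∷ p) (there x∈p) = x∈p⇒1+∣p-x∣≡∣p∣ p x∈p
x∈p⇒1+∣p-x∣≡∣p∣ (inside  ∷ p) (there x∈p) = cong suc (x∈p⇒1+∣p-x∣≡∣p∣ p x∈p)

x∉p⇒∣p∪⁅x⁆∣≡1+∣p∣ : (p : Subset n) (x : Fin n) → x ∉ p → ∣ p ∪ ⁅ x ⁆ ∣ ≡ suc ∣ p ∣
x∉p⇒∣p∪⁅x⁆∣≡1+∣p∣ (outside ∷ p) zero    _   = cong (suc ∘ ∣_∣) (∪-identityʳ p)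
x∉p⇒∣p∪⁅x⁆∣≡1+∣p∣ (inside  ∷ p) zero    x∉p = contradiction here x∉p
x∉p⇒∣p∪⁅x⁆∣≡1+∣p∣ (outside ∷ p) (suc x) x∉p = x∉p⇒∣p∪⁅x⁆∣≡1+∣p∣ p x (x∉p ∘ there)
x∉p⇒∣p∪⁅x⁆∣≡1+∣p∣ (inside  ∷ p) (suc x) x∉p = cong suc (x∉p⇒∣p∪⁅x⁆∣≡1+∣p∣ p x (x∉p ∘ there))

x∈q⇒p∪⁅x⁆─q≡p─q : {x : Fin n} (p q : Subset n) → x ∈ q → (p ∪ ⁅ x ⁆) ─ q ≡ p ─ q
x∈q⇒p∪⁅x⁆─q≡p─q (_       ∷ p) (inside  ∷ q) here        = cong (outside ∷_) (cong (_─ q) (∪-identityʳ p))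
x∈q⇒p∪⁅x⁆─q≡p─q (outside ∷ p) (outside ∷ q) (there x∈q) = cong (outside ∷_) (x∈q⇒p∪⁅x⁆─q≡p─q p q x∈q)
x∈q⇒p∪⁅x⁆─q≡p─q (inside  ∷ p) (outside ∷ q) (there x∈q) = cong (inside  ∷_) (x∈q⇒p∪⁅x⁆─q≡p─q p q x∈q)
x∈q⇒p∪⁅x⁆─q≡p─q (_       ∷ p) (inside  ∷ q) (there x∈q) = cong (outside ∷_) (x∈q⇒p∪⁅x⁆─q≡p─q p q x∈q)

_∈⁺_ : A → List⁺ A → Set
a ∈⁺ xs = Any (_≡ a) (List⁺.toList xs)

min⁺-map : (f : B → ℕ) (g : A → B) (xs : List⁺ A) → min⁺ f (List⁺.map g xs) ≡ min⁺ (f ∘ g) xs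
min⁺-map f g (x ∷ xs) = foldr-map _ g (f (g x)) xs

min⁺-cong-∈ : {f g : A → ℕ} (xs : List⁺ A) → (∀ {a} → a ∈⁺ xs → f a ≡ g a) → min⁺ f xs ≡ min⁺ g xs
min⁺-cong-∈ (x ∷ [])     f≡g = f≡g (Any.here refl)
min⁺-cong-∈ (x ∷ y ∷ ys) f≡g =
  cong₂ _⊓_ (f≡g (Any.there (Any.here refl))) (min⁺-cong-∈ (x ∷ ys) (f≡g ∘ there-tail))
  where
  there-tail : ∀ {a} → a ∈⁺ (x ∷ ys) → a ∈⁺ (x ∷ y ∷ ys)
  there-tail (Any.here a≡x)  = Any.here a≡x
  there-tail (Any.there a∈ys) = Any.there (Any.there a∈ys)

min⁺-const : (k : ℕ) (xs : List⁺ A) → min⁺ (λ _ → k) xs ≡ k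
min⁺-const k (x ∷ [])     = refl
min⁺-const k (x ∷ y ∷ ys) = trans (cong (k ⊓_) (min⁺-const k (x ∷ ys))) (⊓-idem k)

min⁺-mono : {f g : A → ℕ} (xs : List⁺ A) → (∀ a → f a ≤ g a) → min⁺ f xs ≤ min⁺ g xs
min⁺-mono (x ∷ [])     f≤g = f≤g x
min⁺-mono (x ∷ y ∷ ys) f≤g = ⊓-mono-≤ (f≤g y) (min⁺-mono (x ∷ ys) f≤g)

min⁺≤head : (f : A → ℕ) (xs : List⁺ A) → min⁺ f xs ≤ f (List⁺.head xs)
min⁺≤head f (x ∷ [])     = ≤-refl
min⁺≤head f (x ∷ y ∷ ys) = ≤-trans (m⊓n≤n (f y) _) (min⁺≤head f (x ∷ ys))

min⁺-distrib-mono : {h : ℕ → ℕ} → h Preserves _≤_ ⟶ _≤_ →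
                    (f : A → ℕ) (xs : List⁺ A) → min⁺ (h ∘ f) xs ≡ h (min⁺ f xs)
min⁺-distrib-mono h-mono f (x ∷ [])     = refl
min⁺-distrib-mono h-mono f (x ∷ y ∷ ys) =
  trans (cong (_ ⊓_) (min⁺-distrib-mono h-mono f (x ∷ ys)))
        (sym (mono-≤-distrib-⊓ h-mono (f y) (min⁺ f (x ∷ ys))))

sumℤ-cong : {f g : A → ℤ} (xs : List A) → (∀ a → f a ≡ g a) → sumℤ f xs ≡ sumℤ g xs
sumℤ-cong xs f≡g = foldr-cong (λ a s → cong (ℤ._+ s) (f≡g a)) refl xs

[r∸[x∸m]]+m≡d : ∀ {d x m r} → m ≤ d → m ≤ x → d + x ≡ m + m + r → (r ∸ (x ∸ m)) + m ≡ d
[r∸[x∸m]]+m≡d {d} {x} {m} {r} m≤d m≤x d+x≡m+m+r = begin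
  (r ∸ (x ∸ m)) + m                  ≡⟨ cong (λ s → (s ∸ (x ∸ m)) + m) r≡[d∸m]+[x∸m] ⟩
  ((d ∸ m) + (x ∸ m) ∸ (x ∸ m)) + m  ≡⟨ cong (_+ m) (m+n∸n≡m (d ∸ m) (x ∸ m)) ⟩
  (d ∸ m) + m                        ≡⟨ m∸n+n≡m m≤d ⟩
  d                                  ∎
  where
  open ≡-Reasoning
  open +-*-Solver using (solve; _:+_; _:=_)
  r≡[d∸m]+[x∸m] : r ≡ (d ∸ m) + (x ∸ m)
  r≡[d∸m]+[x∸m] = +-cancelʳ-≡ (m + m) r _ (begin
    r + (m + m)                         ≡⟨ +-comm r (m + m) ⟩
    m + m + r                           ≡⟨ d+x≡m+m+r ⟨
    d + x                               ≡⟨ cong₂ _+_ (m∸n+n≡m m≤d) (m∸n+n≡m m≤x) ⟨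
    ((d ∸ m) + m) + ((x ∸ m) + m)       ≡⟨ solve 3 (λ a b c → (a :+ c) :+ (b :+ c) := (a :+ b) :+ (c :+ c))
                                                   refl (d ∸ m) (x ∸ m) m ⟩
    (d ∸ m) + (x ∸ m) + (m + m)         ∎)

module _ {n : ℕ} (D : SetSystem n) (X : Subset n) where

  d-pivot≡dist : d (pivot D X) ≡ dist D X
  d-pivot≡dist = trans (min⁺-map _ (_⊕ X) D) (min⁺-cong-∈ D λ {Z} _ →
    cong ∣_∣ (trans (⊕-identityˡ (Z ⊕ X)) (⊕-comm Z X)))

  nullity≤dist : nullity D X ≤ dist D X
  nullity≤dist = min⁺-mono D λ Z →
    subst (∣ X ─ Z ∣ ≤_) (sym (∣p⊕q∣≡∣p─q∣+∣q─p∣ X Z)) (m≤m+n _ _)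

  nullity≤∣X∣ : nullity D X ≤ ∣ X ∣
  nullity≤∣X∣ = ≤-trans (min⁺≤head _ D) (∣p─q∣≤∣p∣ X (List⁺.head D))

module _ {n : ℕ} {β : SetSystem n} (matroid : IsMatroid β) where

  -- Exchanging an element of B₁ ∖ B₂ for one of B₂ ∖ B₁ keeps |B₁| and shrinks B₁ ∖ B₂.
  ∣B₁∣≤∣B₂∣ : ∀ k {B₁ B₂} → B₁ ∈F β → B₂ ∈F β → ∣ B₁ ─ B₂ ∣ ≡ k → ∣ B₁ ∣ ≤ ∣ B₂ ∣
  ∣B₁∣≤∣B₂∣ zero {B₁} {B₂} _ _ ∣B₁─B₂∣≡0 = begin
    ∣ B₁ ∣                 ≤⟨ m≤m+n _ _ ⟩
    ∣ B₁ ∣ + ∣ B₂ ─ B₁ ∣   ≡⟨ ∣p∣+∣q─p∣≡∣q∣+∣p─q∣ B₁ B₂ ⟩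
    ∣ B₂ ∣ + ∣ B₁ ─ B₂ ∣   ≡⟨ cong (_+_ ∣ B₂ ∣) ∣B₁─B₂∣≡0 ⟩
    ∣ B₂ ∣ + 0             ≡⟨ +-identityʳ _ ⟩
    ∣ B₂ ∣                 ∎
    where open ≤-Reasoning
  ∣B₁∣≤∣B₂∣ (suc k) {B₁} {B₂} B₁∈β B₂∈β ∣B₁─B₂∣≡1+k
    with x , x∈B₁─B₂ ← ∣p∣>0⇒Nonempty (B₁ ─ B₂) (subst (0 <_) (sym ∣B₁─B₂∣≡1+k) z<s)
    with y , y∈B₂ , y∉B₁ , B₁′∈β ← matroid B₁ B₂ B₁∈β B₂∈β x (p─q⊆p B₁ B₂ x∈B₁─B₂) (x∈p─q⇒x∉q B₁ B₂ x∈B₁─B₂)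
    = subst (_≤ ∣ B₂ ∣) ∣B₁′∣≡∣B₁∣ (∣B₁∣≤∣B₂∣ k B₁′∈β B₂∈β ∣B₁′─B₂∣≡k)
    where
    B₁′ : Subset n
    B₁′ = (B₁ ─ ⁅ x ⁆) ∪ ⁅ y ⁆
    ∣B₁′∣≡∣B₁∣ : ∣ B₁′ ∣ ≡ ∣ B₁ ∣
    ∣B₁′∣≡∣B₁∣ = trans (x∉p⇒∣p∪⁅x⁆∣≡1+∣p∣ (B₁ ─ ⁅ x ⁆) y (y∉B₁ ∘ p─q⊆p B₁ ⁅ x ⁆))
                       (x∈p⇒1+∣p-x∣≡∣p∣ B₁ (p─q⊆p B₁ B₂ x∈B₁─B₂))
    ∣B₁′─B₂∣≡k : ∣ B₁′ ─ B₂ ∣ ≡ k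
    ∣B₁′─B₂∣≡k = suc-injective (begin
      suc ∣ B₁′ ─ B₂ ∣             ≡⟨ cong (suc ∘ ∣_∣) (x∈q⇒p∪⁅x⁆─q≡p─q (B₁ ─ ⁅ x ⁆) B₂ y∈B₂) ⟩
      suc ∣ B₁ ─ ⁅ x ⁆ ─ B₂ ∣      ≡⟨ cong (suc ∘ ∣_∣) (p─q─r≡p─r─q B₁ ⁅ x ⁆ B₂) ⟩
      suc ∣ B₁ ─ B₂ ─ ⁅ x ⁆ ∣      ≡⟨ x∈p⇒1+∣p-x∣≡∣p∣ (B₁ ─ B₂) x∈B₁─B₂ ⟩
      ∣ B₁ ─ B₂ ∣                  ≡⟨ ∣B₁─B₂∣≡1+k ⟩
      suc k                        ∎)
      where open ≡-Reasoning

  bases-equicardinal : ∀ {B₁ B₂} → B₁ ∈F β → B₂ ∈F β → ∣ B₁ ∣ ≡ ∣ B₂ ∣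
  bases-equicardinal B₁∈β B₂∈β =
    ≤-antisym (∣B₁∣≤∣B₂∣ _ B₁∈β B₂∈β refl) (∣B₁∣≤∣B₂∣ _ B₂∈β B₁∈β refl)

module _ {n : ℕ} (β : SetSystem n) (matroid : IsMatroid β) where

  private
    r : ℕ
    r = ∣ List⁺.head β ∣

  ∣B∣≡r : ∀ {B} → B ∈F β → ∣ B ∣ ≡ r
  ∣B∣≡r B∈β = bases-equicardinal matroid B∈β (Any.here refl)

  nullity-⊤ : nullity β ⊤ ≡ n ∸ r
  nullity-⊤ = trans (min⁺-cong-∈ β ∣⊤─B∣≡n∸r) (min⁺-const (n ∸ r) β)
    where
    ∣⊤─B∣≡n∸r : ∀ {B} → B ∈F β → ∣ ⊤ ─ B ∣ ≡ n ∸ r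
    ∣⊤─B∣≡n∸r {B} B∈β = begin
      ∣ ⊤ ─ B ∣                  ≡⟨ m+n∸m≡n ∣ B ∣ _ ⟨
      ∣ B ∣ + ∣ ⊤ ─ B ∣ ∸ ∣ B ∣  ≡⟨ cong₂ _∸_ (∣p∣+∣q─p∣≡∣q∣+∣p─q∣ B ⊤) (∣B∣≡r B∈β) ⟩
      ∣ ⊤ {n} ∣ + ∣ B ─ ⊤ ∣ ∸ r  ≡⟨ cong (λ k → ∣ ⊤ {n} ∣ + k ∸ r) (trans (cong ∣_∣ (p─⊤≡⊥ B)) (∣⊥∣≡0 n)) ⟩
      ∣ ⊤ {n} ∣ + 0 ∸ r          ≡⟨ cong (_∸ r) (trans (+-identityʳ _) (∣⊤∣≡n n)) ⟩
      n ∸ r                      ∎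
      where open ≡-Reasoning

  rank-⊤ : rank β ⊤ ≡ r
  rank-⊤ = trans (cong₂ _∸_ (∣⊤∣≡n n) nullity-⊤) (m∸[m∸n]≡n (∣p∣≤n (List⁺.head β)))

  dist+∣X∣≡2nullity+r : ∀ X → dist β X + ∣ X ∣ ≡ nullity β X + nullity β X + r
  dist+∣X∣≡2nullity+r X = begin
    dist β X + ∣ X ∣                      ≡⟨ min⁺-distrib-mono (+-monoˡ-≤ ∣ X ∣) _ β ⟨
    min⁺ (λ Z → ∣ X ⊕ Z ∣ + ∣ X ∣) β      ≡⟨ min⁺-cong-∈ β pointwise ⟩
    min⁺ (λ Z → ∣ X ─ Z ∣ + ∣ X ─ Z ∣ + r) β
      ≡⟨ min⁺-distrib-mono (λ m≤m′ → +-monoˡ-≤ r (+-mono-≤ m≤m′ m≤m′)) _ β ⟩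
    nullity β X + nullity β X + r         ∎
    where
    open ≡-Reasoning
    pointwise : ∀ {Z} → Z ∈F β → ∣ X ⊕ Z ∣ + ∣ X ∣ ≡ ∣ X ─ Z ∣ + ∣ X ─ Z ∣ + r
    pointwise {Z} Z∈β = begin
      ∣ X ⊕ Z ∣ + ∣ X ∣                    ≡⟨ cong (_+ ∣ X ∣) (∣p⊕q∣≡∣p─q∣+∣q─p∣ X Z) ⟩
      ∣ X ─ Z ∣ + ∣ Z ─ X ∣ + ∣ X ∣        ≡⟨ +-assoc ∣ X ─ Z ∣ _ _ ⟩
      ∣ X ─ Z ∣ + (∣ Z ─ X ∣ + ∣ X ∣)      ≡⟨ cong (_+_ ∣ X ─ Z ∣) (+-comm ∣ Z ─ X ∣ ∣ X ∣) ⟩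
      ∣ X ─ Z ∣ + (∣ X ∣ + ∣ Z ─ X ∣)      ≡⟨ cong (_+_ ∣ X ─ Z ∣) (∣p∣+∣q─p∣≡∣q∣+∣p─q∣ X Z) ⟩
      ∣ X ─ Z ∣ + (∣ Z ∣ + ∣ X ─ Z ∣)      ≡⟨ cong (λ k → ∣ X ─ Z ∣ + (k + ∣ X ─ Z ∣)) (∣B∣≡r Z∈β) ⟩
      ∣ X ─ Z ∣ + (r + ∣ X ─ Z ∣)          ≡⟨ cong (_+_ ∣ X ─ Z ∣) (+-comm r _) ⟩
      ∣ X ─ Z ∣ + (∣ X ─ Z ∣ + r)          ≡⟨ +-assoc ∣ X ─ Z ∣ _ _ ⟨
      ∣ X ─ Z ∣ + ∣ X ─ Z ∣ + r            ∎

  tutte-exponent≡d-pivot : ∀ X → (rank β ⊤ ∸ rank β X) + nullity β X ≡ d (pivot β X)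
  tutte-exponent≡d-pivot X = begin
    (rank β ⊤ ∸ rank β X) + nullity β X   ≡⟨ cong (λ k → (k ∸ rank β X) + nullity β X) rank-⊤ ⟩
    (r ∸ (∣ X ∣ ∸ nullity β X)) + nullity β X
      ≡⟨ [r∸[x∸m]]+m≡d (nullity≤dist β X) (nullity≤∣X∣ β X) (dist+∣X∣≡2nullity+r X) ⟩
    dist β X                              ≡⟨ d-pivot≡dist β X ⟨
    d (pivot β X)                         ∎
    where open ≡-Reasoning

theorem12 : (n : ℕ) (β : SetSystem n) → IsMatroid β →
    (y : ℤ) → tutte β y y ≡ q₁ β (y - + 1)
theorem12 n β matroid y = sumℤ-cong (allSubsets n) λ X →
  trans (sym (ℤ.^-distribˡ-+-* (y - + 1) (rank β ⊤ ∸ rank β X) (nullity β X)))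
        (cong ((y - + 1) ℤ.^_) (tutte-exponent≡d-pivot β matroid X))
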